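{- Let $\mathcal M$ be an intuitionistic (Heyting-algebra valued) model of $\mathrm{Z}_{st}$ with domain $\mathcal M$ and underlying Heyting algebra $B$. Let $\mathcal M'$ be the two-sorted structure with the same Heyting algebra $B$, in which the sort $\mathrm{Set}$ is interpreted by $\mathcal M$, the sort $\mathrm{Class}$ is interpreted by the set of definable functions from $\mathcal M$ to $B$, the symbols $=$ and $\in$ are interpreted as in $\mathcal M$, and $\mathrm{mem}$ is interpreted by function application ($[\![\mathrm{mem}(a,E)]\!]=E(a)$). Then $\mathcal M'$ is a model of $\mathrm{Z}_{class}$.
   Context: The theory $\mathrm{Z}_{st}$ is the first-order theory in the language with binary predicates $=$ and $\in$ with axioms: $\forall x\,(x=x)$; $\forall x\forall x'\forall y(x=x'\land x=y\Rightarrow x'=y)$; $\forall x\forall x'\forall y(x=x'\land x\in y\Rightarrow x'\in y)$; $\forall x\forall y\forall y'(y=y'\land x\in y\Rightarrow x\in y')$; Strong Extensionality: for each formula $R(x,y)$ with free variables among $x_1,\dots,x_n,x,y$, $\forall x_1\cdots\forall x_n\forall a\forall b\,(R(a,b)\land\forall x\forall x'\forall y(x'\in x\land R(x,y)\Rightarrow\exists y'(y'\in y\land R(x',y')))\land\forall y\forall y'\forall x(y'\in y\land R(x,y)\Rightarrow\exists x'(x'\in x\land R(x',y')))\Rightarrow a=b)$; Pairing $\forall a\forall b\exists e\forall x(x\in e\Leftrightarrow x=a\lor x=b)$; Union $\forall a\exists e\forall x(x\in e\Leftrightarrow\exists y(x\in y\land y\in a))$; Powerset $\forall a\exists e\forall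 x(x\in e\Leftrightarrow\forall z(z\in x\Rightarrow z\in a))$; Restricted Comprehension: for each formula $P(x)$ with free variables among $x_1,\dots,x_n,a,x$, $\forall x_1\cdots\forall x_n\forall a\exists e\forall x(x\in e\Leftrightarrow x\in a\land P(x))$; Infinity $\exists e\,\mathrm{Ind}(e)$, where $\mathrm{Ind}(c)\equiv \forall a(\forall x\neg(x\in a)\Rightarrow a\in c)\land\forall a(a\in c\Rightarrow\forall b(\forall x(x\in b\Leftrightarrow x\in a\lor x=a)\Rightarrow b\in c))$; Transitive Closure $\forall a\exists e(\forall z(z\in a\Rightarrow z\in e)\land\forall x\forall y(x\in y\land y\in e\Rightarrow x\in e))$. A function $E:\mathcal M\to B$ is definable if there are a formula $P$ of the language of $\mathrm{Z}_{st}$ with free variables among $x,y_1,\dots,y_n$ and elements $b_1,\dots,b_n\in\mathcal M$ such that for all $a\in\mathcal M$, $[\![P]\!]_{a/x,b_1/y_1,\dots,b_n/y_n}=E(a)$. $\mathrm{Z}_{class}$ is the two-sorted theory (sorts $\mathrm{Set}$, $\mathrm{Class}$) with predicates $=,\in$ of rank $\langle\mathrm{Set},\mathrm{Set}\rangle$ and $\mathrm{mem}$ of rank $\langle\mathrm{Set},\mathrm{Class}\rangle$, whose axioms are: the equality axioms of $\mathrm{Z}_{st}$ and $\forall x\forall y\forall p(x=y\land\mathrm{mem}(x,p)\Rightarrow\mathrm{mem}(y,p))$; the Strong Extensionality scheme and the Restricted Comprehension scheme of $\mathrm{Z}_{st}$ generalized to all formulas possibly containing $\mathrm{mem}$ and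 free class variables but no quantification over classes; the Pairing, Union, Powerset, Infinity and Transitive Closure axioms; and the class comprehension scheme $\exists\alpha\forall x(\mathrm{mem}(x,\alpha)\Leftrightarrow P)$ for every formula $P$ possibly containing $\mathrm{mem}$ and free class variables but no quantification over classes. -}

module Defs where

open import Data.Nat using (ℕ; zero; suc; _+_)
open import Data.Fin using (Fin; zero; suc; _↑ʳ_; #_)
open import Data.Product using (Σ; ∃; _×_; _,_; proj₁)
open import Data.Vec.Functional using (Vector; _∷_)
open import Level using (0ℓ)
open import Relation.Binary.Lattice.Bundles using (HeytingAlgebra)

record CompleteHeytingAlgebra : Set₁ where
  field
    heyting : HeytingAlgebra 0ℓ 0ℓ 0ℓ
  open HeytingAlgebra heyting public
  field
    ⋀       : {I : Set} → (I → Carrier) → Carrier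
    ⋀-lower : {I : Set} (f : I → Carrier) (i : I) → ⋀ f ≤ f i
    ⋀-glb   : {I : Set} (f : I → Carrier) (x : Carrier) →
              ((i : I) → x ≤ f i) → x ≤ ⋀ f
    ⋁       : {I : Set} → (I → Carrier) → Carrier
    ⋁-upper : {I : Set} (f : I → Carrier) (i : I) → f i ≤ ⋁ f
    ⋁-lub   : {I : Set} (f : I → Carrier) (x : Carrier) →
              ((i : I) → f i ≤ x) → ⋁ f ≤ x

-- Syntax of the language of Z_st (de Bruijn variables; variable 0 is
-- the innermost bound one).  Negation, ⇔ are abbreviations.

infixr 6 _∧̇_
infixr 5 _∨̇_
infixr 4 _⇒̇_ _⇔̇_
infix 7 _≐_ _∈̇_

data Fm (n : ℕ) : Set where
  _≐_ _∈̇_        : Fin n → Fin n → Fm n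
  ⊥̇              : Fm n
  _∧̇_ _∨̇_ _⇒̇_    : Fm n → Fm n → Fm n
  ∀̇ ∃̇            : Fm (suc n) → Fm n

¬̇_ : ∀ {n} → Fm n → Fm n
¬̇ φ = φ ⇒̇ ⊥̇

_⇔̇_ : ∀ {n} → Fm n → Fm n → Fm n
φ ⇔̇ ψ = (φ ⇒̇ ψ) ∧̇ (ψ ⇒̇ φ)

ext : ∀ {n n'} → (Fin n → Fin n') → Fin (suc n) → Fin (suc n')
ext ρ zero    = zero
ext ρ (suc i) = suc (ρ i)

ren : ∀ {n n'} → (Fin n → Fin n') → Fm n → Fm n'
ren ρ (i ≐ j)  = ρ i ≐ ρ j
ren ρ (i ∈̇ j)  = ρ i ∈̇ ρ j
ren ρ ⊥̇        = ⊥̇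
ren ρ (φ ∧̇ ψ)  = ren ρ φ ∧̇ ren ρ ψ
ren ρ (φ ∨̇ ψ)  = ren ρ φ ∨̇ ren ρ ψ
ren ρ (φ ⇒̇ ψ)  = ren ρ φ ⇒̇ ren ρ ψ
ren ρ (∀̇ φ)    = ∀̇ (ren (ext ρ) φ)
ren ρ (∃̇ φ)    = ∃̇ (ren (ext ρ) φ)

close : (k : ℕ) → Fm k → Fm 0
close zero    φ = φ
close (suc k) φ = close k (∀̇ φ)

pick : ∀ {k n} → Fin n → Fin n → (Fin k → Fin n) → Fin (suc (suc k)) → Fin n
pick i j p zero          = i
pick i j p (suc zero)    = j
pick i j p (suc (suc l)) = p l

-- Strong extensionality instance for R(x,y) (x = var 0, y = var 1,
-- parameters x₁..x_k = vars 2..k+1):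
-- ∀x₁..x_k ∀a ∀b (R(a,b) ∧ ∀x∀x'∀y(x'∈x ∧ R(x,y) ⇒ ∃y'(y'∈y ∧ R(x',y')))
--               ∧ ∀y∀y'∀x(y'∈y ∧ R(x,y) ⇒ ∃x'(x'∈x ∧ R(x',y'))) ⇒ a = b)
SE-body : ∀ {k} → Fm (suc (suc k)) → Fm (suc (suc k))
SE-body {k} R =
  -- context: b = 0, a = 1, params 2+l
  (ren (pick (# 1) (# 0) (2 ↑ʳ_)) R
   ∧̇ ∀̇ (∀̇ (∀̇ (  -- y = 0, x' = 1, x = 2, params 5+l
        (# 1 ∈̇ # 2 ∧̇ ren (pick (# 2) (# 0) (5 ↑ʳ_)) R)
        ⇒̇ ∃̇ (    -- y' = 0, y = 1, x' = 2, x = 3, params 6+l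
              # 0 ∈̇ # 1 ∧̇ ren (pick (# 2) (# 0) (6 ↑ʳ_)) R))))
   ∧̇ ∀̇ (∀̇ (∀̇ (  -- x = 0, y' = 1, y = 2, params 5+l
        (# 1 ∈̇ # 2 ∧̇ ren (pick (# 0) (# 2) (5 ↑ʳ_)) R)
        ⇒̇ ∃̇ (    -- x' = 0, x = 1, y' = 2, y = 3, params 6+l
              # 0 ∈̇ # 1 ∧̇ ren (pick (# 0) (# 2) (6 ↑ʳ_)) R)))))
  ⇒̇ # 1 ≐ # 0

SE : (k : ℕ) → Fm (suc (suc k)) → Fm 0
SE k R = close k (∀̇ (∀̇ (SE-body R)))

-- Restricted comprehension instance for P(x) (x = var 0, a = var 1,
-- parameters = vars 2..k+1): ∀x₁..x_k ∀a ∃e ∀x (x∈e ⇔ x∈a ∧ P(x))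
RC : (k : ℕ) → Fm (suc (suc k)) → Fm 0
RC k P = close k (∀̇ (∃̇ (∀̇ (  -- x = 0, e = 1, a = 2, params 3+l
  # 0 ∈̇ # 1 ⇔̇ (# 0 ∈̇ # 2 ∧̇ ren (pick (# 0) (# 2) (3 ↑ʳ_)) P)))))

EqRefl EqTrans EqMemL EqMemR Pairing Union Powerset Infinity TransClosure : Fm 0
EqRefl  = ∀̇ (# 0 ≐ # 0)
-- ∀x∀x'∀y (x=x' ∧ x=y ⇒ x'=y)     (y = 0, x' = 1, x = 2)
EqTrans = ∀̇ (∀̇ (∀̇ ((# 2 ≐ # 1 ∧̇ # 2 ≐ # 0) ⇒̇ # 1 ≐ # 0)))
-- ∀x∀x'∀y (x=x' ∧ x∈y ⇒ x'∈y)     (y = 0, x' = 1, x = 2)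
EqMemL  = ∀̇ (∀̇ (∀̇ ((# 2 ≐ # 1 ∧̇ # 2 ∈̇ # 0) ⇒̇ # 1 ∈̇ # 0)))
-- ∀x∀y∀y' (y=y' ∧ x∈y ⇒ x∈y')     (y' = 0, y = 1, x = 2)
EqMemR  = ∀̇ (∀̇ (∀̇ ((# 1 ≐ # 0 ∧̇ # 2 ∈̇ # 1) ⇒̇ # 2 ∈̇ # 0)))
-- ∀a∀b∃e∀x (x∈e ⇔ x=a ∨ x=b)       (x = 0, e = 1, b = 2, a = 3)
Pairing = ∀̇ (∀̇ (∃̇ (∀̇ (# 0 ∈̇ # 1 ⇔̇ (# 0 ≐ # 3 ∨̇ # 0 ≐ # 2)))))
-- ∀a∃e∀x (x∈e ⇔ ∃y(x∈y ∧ y∈a))    (x = 0, e = 1, a = 2; under ∃y: y = 0)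
Union   = ∀̇ (∃̇ (∀̇ (# 0 ∈̇ # 1 ⇔̇ ∃̇ (# 1 ∈̇ # 0 ∧̇ # 0 ∈̇ # 3))))
-- ∀a∃e∀x (x∈e ⇔ ∀z(z∈x ⇒ z∈a))    (x = 0, e = 1, a = 2; under ∀z: z = 0)
Powerset = ∀̇ (∃̇ (∀̇ (# 0 ∈̇ # 1 ⇔̇ ∀̇ (# 0 ∈̇ # 1 ⇒̇ # 0 ∈̇ # 3))))

-- Ind(c), c = var 0
Ind : Fm 1
Ind = ∀̇ ((∀̇ (¬̇ (# 0 ∈̇ # 1))) ⇒̇ # 0 ∈̇ # 1)          -- a = 0, c = 1
   ∧̇ ∀̇ (# 0 ∈̇ # 1 ⇒̇                                  -- a = 0, c = 1
        ∀̇ ((∀̇ (# 0 ∈̇ # 1 ⇔̇ (# 0 ∈̇ # 2 ∨̇ # 0 ≐ # 2)))  -- b = 0, a = 1, c = 2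
            ⇒̇ # 0 ∈̇ # 2))

Infinity = ∃̇ Ind
-- ∀a∃e (∀z(z∈a ⇒ z∈e) ∧ ∀x∀y(x∈y ∧ y∈e ⇒ x∈e))   (e = 0, a = 1)
TransClosure = ∀̇ (∃̇ (∀̇ (# 0 ∈̇ # 2 ⇒̇ # 0 ∈̇ # 1)
                    ∧̇ ∀̇ (∀̇ ((# 1 ∈̇ # 0 ∧̇ # 0 ∈̇ # 2) ⇒̇ # 1 ∈̇ # 2))))

data AxZst : Fm 0 → Set where
  eqRefl       : AxZst EqRefl
  eqTrans      : AxZst EqTrans
  eqMemL       : AxZst EqMemL
  eqMemR       : AxZst EqMemR
  strongExt    : (k : ℕ) (R : Fm (suc (suc k))) → AxZst (SE k R)
  pairing      : AxZst Pairing
  union        : AxZst Union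
  powerset     : AxZst Powerset
  restrComp    : (k : ℕ) (P : Fm (suc (suc k))) → AxZst (RC k P)
  infinity     : AxZst Infinity
  transClosure : AxZst TransClosure

record ZStructure (B : CompleteHeytingAlgebra) : Set₁ where
  open CompleteHeytingAlgebra B
  field
    Dom  : Set
    eqᴮ  : Dom → Dom → Carrier
    memᴮ : Dom → Dom → Carrier

module _ {B : CompleteHeytingAlgebra} (M : ZStructure B) where
  open CompleteHeytingAlgebra B
  open ZStructure M

  ⟦_⟧ : ∀ {n} → Fm n → Vector Dom n → Carrier
  ⟦ i ≐ j ⟧ ρ  = eqᴮ (ρ i) (ρ j)
  ⟦ i ∈̇ j ⟧ ρ  = memᴮ (ρ i) (ρ j)
  ⟦ ⊥̇ ⟧ ρ      = ⊥
  ⟦ φ ∧̇ ψ ⟧ ρ  = ⟦ φ ⟧ ρ ∧ ⟦ ψ ⟧ ρ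
  ⟦ φ ∨̇ ψ ⟧ ρ  = ⟦ φ ⟧ ρ ∨ ⟦ ψ ⟧ ρ
  ⟦ φ ⇒̇ ψ ⟧ ρ  = ⟦ φ ⟧ ρ ⇨ ⟦ ψ ⟧ ρ
  ⟦ ∀̇ φ ⟧ ρ    = ⋀ (λ a → ⟦ φ ⟧ (a ∷ ρ))
  ⟦ ∃̇ φ ⟧ ρ    = ⋁ (λ a → ⟦ φ ⟧ (a ∷ ρ))

  IsZstModel : Set
  IsZstModel = (φ : Fm 0) → AxZst φ → ⟦ φ ⟧ (λ ()) ≈ ⊤

  Definable : (Dom → Carrier) → Set
  Definable E = Σ ℕ λ n → Σ (Fm (suc n)) λ P → Σ (Vector Dom n) λ b →
                (a : Dom) → ⟦ P ⟧ (a ∷ b) ≈ E a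

-- Two-sorted syntax of Z_class: n set variables, m class variables

data Fm2 (n m : ℕ) : Set where
  _≐_ _∈̇_        : Fin n → Fin n → Fm2 n m
  mem            : Fin n → Fin m → Fm2 n m
  ⊥̇              : Fm2 n m
  _∧̇_ _∨̇_ _⇒̇_    : Fm2 n m → Fm2 n m → Fm2 n m
  ∀s ∃s          : Fm2 (suc n) m → Fm2 n m
  ∀c ∃c          : Fm2 n (suc m) → Fm2 n m

_⇔₂_ : ∀ {n m} → Fm2 n m → Fm2 n m → Fm2 n m
φ ⇔₂ ψ = (φ ⇒̇ ψ) ∧̇ (ψ ⇒̇ φ)
infixr 4 _⇔₂_

data NoClassQ {n m : ℕ} : Fm2 n m → Set where
  eq  : ∀ i j → NoClassQ (i ≐ j)
  el  : ∀ i j → NoClassQ (i ∈̇ j)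
  mb  : ∀ i p → NoClassQ (mem i p)
  bot : NoClassQ ⊥̇
  and : ∀ {φ ψ} → NoClassQ φ → NoClassQ ψ → NoClassQ (φ ∧̇ ψ)
  or  : ∀ {φ ψ} → NoClassQ φ → NoClassQ ψ → NoClassQ (φ ∨̇ ψ)
  imp : ∀ {φ ψ} → NoClassQ φ → NoClassQ ψ → NoClassQ (φ ⇒̇ ψ)
  all : ∀ {φ} → NoClassQ {suc n} {m} φ → NoClassQ (∀s φ)
  ex  : ∀ {φ} → NoClassQ {suc n} {m} φ → NoClassQ (∃s φ)

ren2 : ∀ {n n' m m'} → (Fin n → Fin n') → (Fin m → Fin m') → Fm2 n m → Fm2 n' m'
ren2 ρ σ (i ≐ j)   = ρ i ≐ ρ j
ren2 ρ σ (i ∈̇ j)   = ρ i ∈̇ ρ j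
ren2 ρ σ (mem i p) = mem (ρ i) (σ p)
ren2 ρ σ ⊥̇         = ⊥̇
ren2 ρ σ (φ ∧̇ ψ)   = ren2 ρ σ φ ∧̇ ren2 ρ σ ψ
ren2 ρ σ (φ ∨̇ ψ)   = ren2 ρ σ φ ∨̇ ren2 ρ σ ψ
ren2 ρ σ (φ ⇒̇ ψ)   = ren2 ρ σ φ ⇒̇ ren2 ρ σ ψ
ren2 ρ σ (∀s φ)    = ∀s (ren2 (ext ρ) σ φ)
ren2 ρ σ (∃s φ)    = ∃s (ren2 (ext ρ) σ φ)
ren2 ρ σ (∀c φ)    = ∀c (ren2 ρ (ext σ) φ)
ren2 ρ σ (∃c φ)    = ∃c (ren2 ρ (ext σ) φ)

emb : ∀ {n m} → Fm n → Fm2 n m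
emb (i ≐ j)  = i ≐ j
emb (i ∈̇ j)  = i ∈̇ j
emb ⊥̇        = ⊥̇
emb (φ ∧̇ ψ)  = emb φ ∧̇ emb ψ
emb (φ ∨̇ ψ)  = emb φ ∨̇ emb ψ
emb (φ ⇒̇ ψ)  = emb φ ⇒̇ emb ψ
emb (∀̇ φ)    = ∀s (emb φ)
emb (∃̇ φ)    = ∃s (emb φ)

closeS : ∀ {m} (k : ℕ) → Fm2 k m → Fm2 0 m
closeS zero    φ = φ
closeS (suc k) φ = closeS k (∀s φ)

closeC : (m : ℕ) → Fm2 0 m → Fm2 0 0
closeC zero    φ = φ
closeC (suc m) φ = closeC m (∀c φ)

-- ∀x∀y∀p (x = y ∧ mem(x,p) ⇒ mem(y,p))   (sets: y = 0, x = 1; class p = 0)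
MemEq : Fm2 0 0
MemEq = ∀s (∀s (∀c ((# 1 ≐ # 0 ∧̇ mem (# 1) (# 0)) ⇒̇ mem (# 0) (# 0))))

SE2 : (k m : ℕ) → Fm2 (suc (suc k)) m → Fm2 0 0
SE2 k m R = closeC m (closeS k (∀s (∀s (
  (ren2 (pick (# 1) (# 0) (2 ↑ʳ_)) idC R
   ∧̇ ∀s (∀s (∀s (
        (# 1 ∈̇ # 2 ∧̇ ren2 (pick (# 2) (# 0) (5 ↑ʳ_)) idC R)
        ⇒̇ ∃s (# 0 ∈̇ # 1 ∧̇ ren2 (pick (# 2) (# 0) (6 ↑ʳ_)) idC R))))
   ∧̇ ∀s (∀s (∀s (
        (# 1 ∈̇ # 2 ∧̇ ren2 (pick (# 0) (# 2) (5 ↑ʳ_)) idC R)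
        ⇒̇ ∃s (# 0 ∈̇ # 1 ∧̇ ren2 (pick (# 0) (# 2) (6 ↑ʳ_)) idC R)))))
  ⇒̇ # 1 ≐ # 0))))
  where idC : Fin m → Fin m
        idC p = p

RC2 : (k m : ℕ) → Fm2 (suc (suc k)) m → Fm2 0 0
RC2 k m P = closeC m (closeS k (∀s (∃s (∀s (
  # 0 ∈̇ # 1 ⇔₂ (# 0 ∈̇ # 2 ∧̇ ren2 (pick (# 0) (# 2) (3 ↑ʳ_)) (λ p → p) P))))))

-- Class comprehension: for P with x = var 0, set parameters 1..k and
-- class parameters 0..m-1:  ∀params ∃α ∀x (mem(x,α) ⇔ P)
CC : (k m : ℕ) → Fm2 (suc k) m → Fm2 0 0
CC k m P = closeC m (closeS k (∃c (∀s (mem (# 0) (# 0) ⇔₂ ren2 (λ i → i) suc P))))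

data AxZclass : Fm2 0 0 → Set where
  eqRefl       : AxZclass (emb EqRefl)
  eqTrans      : AxZclass (emb EqTrans)
  eqMemL       : AxZclass (emb EqMemL)
  eqMemR       : AxZclass (emb EqMemR)
  memEq        : AxZclass MemEq
  strongExt    : (k m : ℕ) (R : Fm2 (suc (suc k)) m) → NoClassQ R → AxZclass (SE2 k m R)
  restrComp    : (k m : ℕ) (P : Fm2 (suc (suc k)) m) → NoClassQ P → AxZclass (RC2 k m P)
  pairing      : AxZclass (emb Pairing)
  union        : AxZclass (emb Union)
  powerset     : AxZclass (emb Powerset)
  infinity     : AxZclass (emb Infinity)
  transClosure : AxZclass (emb TransClosure)
  classComp    : (k m : ℕ) (P : Fm2 (suc k) m) → NoClassQ P → AxZclass (CC k m P)

record Z2Structure (B : CompleteHeytingAlgebra) : Set₁ where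
  open CompleteHeytingAlgebra B
  field
    SetDom   : Set
    ClassDom : Set
    eqᴮ      : SetDom → SetDom → Carrier
    memᴮ     : SetDom → SetDom → Carrier
    memCᴮ    : SetDom → ClassDom → Carrier

module _ {B : CompleteHeytingAlgebra} (N : Z2Structure B) where
  open CompleteHeytingAlgebra B
  open Z2Structure N

  ⟦_⟧₂ : ∀ {n m} → Fm2 n m → Vector SetDom n → Vector ClassDom m → Carrier
  ⟦ i ≐ j ⟧₂ ρ σ   = eqᴮ (ρ i) (ρ j)
  ⟦ i ∈̇ j ⟧₂ ρ σ   = memᴮ (ρ i) (ρ j)
  ⟦ mem i p ⟧₂ ρ σ = memCᴮ (ρ i) (σ p)
  ⟦ ⊥̇ ⟧₂ ρ σ       = ⊥
  ⟦ φ ∧̇ ψ ⟧₂ ρ σ   = ⟦ φ ⟧₂ ρ σ ∧ ⟦ ψ ⟧₂ ρ σ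
  ⟦ φ ∨̇ ψ ⟧₂ ρ σ   = ⟦ φ ⟧₂ ρ σ ∨ ⟦ ψ ⟧₂ ρ σ
  ⟦ φ ⇒̇ ψ ⟧₂ ρ σ   = ⟦ φ ⟧₂ ρ σ ⇨ ⟦ ψ ⟧₂ ρ σ
  ⟦ ∀s φ ⟧₂ ρ σ    = ⋀ (λ a → ⟦ φ ⟧₂ (a ∷ ρ) σ)
  ⟦ ∃s φ ⟧₂ ρ σ    = ⋁ (λ a → ⟦ φ ⟧₂ (a ∷ ρ) σ)
  ⟦ ∀c φ ⟧₂ ρ σ    = ⋀ (λ E → ⟦ φ ⟧₂ ρ (E ∷ σ))
  ⟦ ∃c φ ⟧₂ ρ σ    = ⋁ (λ E → ⟦ φ ⟧₂ ρ (E ∷ σ))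

  IsZclassModel : Set
  IsZclassModel = (φ : Fm2 0 0) → AxZclass φ → ⟦ φ ⟧₂ (λ ()) (λ ()) ≈ ⊤

M' : {B : CompleteHeytingAlgebra} → ZStructure B → Z2Structure B
M' {B} M = record
  { SetDom   = Dom
  ; ClassDom = Σ (Dom → Carrier) (Definable M)
  ; eqᴮ      = eqᴮ
  ; memᴮ     = memᴮ
  ; memCᴮ    = λ a E → proj₁ E a
  }
  where open CompleteHeytingAlgebra B
        open ZStructure M

-- A definable class is given by a formula with parameters, and finitely many
-- classes by formulas over one common list of parameters.  Replacing every
-- mem(x, E) by the defining formula of E turns a formula without class
-- quantifiers into a formula of Z_st with the same truth value, so strong
-- extensionality and restricted comprehension of Z_class become instances of
-- the corresponding schemes of Z_st, and for class comprehension the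
-- translated formula itself defines the required class.  Definable classes
-- respect equality since, by the equality axioms, every formula does.

module Submission where

open import Defs
open import Data.Nat using (ℕ; zero; suc; _+_)
open import Data.Fin using (Fin; zero; suc; _↑ˡ_; _↑ʳ_; #_)
open import Data.Product using (_,_; proj₁; proj₂)
open import Data.Vec.Functional using (Vector; _∷_; _++_)
open import Data.Vec.Functional.Properties using (∷-cong; lookup-++ˡ; lookup-++ʳ)
open import Function using (id; _∘_)
open import Relation.Binary.PropositionalEquality
  using (_≡_; _≗_; refl; sym; cong; cong₂; subst)
import Relation.Binary.Lattice.Properties.HeytingAlgebra as HeytingAlgebraProperties
import Relation.Binary.Lattice.Properties.JoinSemilattice as JoinSemilatticeProperties
import Relation.Binary.Lattice.Properties.MeetSemilattice as MeetSemilatticeProperties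

module CompleteHeytingAlgebraProperties (B : CompleteHeytingAlgebra) where
  open CompleteHeytingAlgebra B renaming (refl to ≤-refl; trans to ≤-trans)
  open HeytingAlgebraProperties heyting public using (⇨-cong; ⇨-eval; swap-transpose-⇨)
  open JoinSemilatticeProperties joinSemilattice public using (∨-cong)
  open MeetSemilatticeProperties meetSemilattice public using (∧-cong)

  ⋀-cong : {I : Set} {f g : I → Carrier} → (∀ i → f i ≈ g i) → ⋀ f ≈ ⋀ g
  ⋀-cong {f = f} {g} f≈g = antisym
    (⋀-glb g (⋀ f) λ i → ≤-trans (⋀-lower f i) (reflexive (f≈g i)))
    (⋀-glb f (⋀ g) λ i → ≤-trans (⋀-lower g i) (reflexive (Eq.sym (f≈g i))))

  ⋁-cong : {I : Set} {f g : I → Carrier} → (∀ i → f i ≈ g i) → ⋁ f ≈ ⋁ g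
  ⋁-cong {f = f} {g} f≈g = antisym
    (⋁-lub f (⋁ g) λ i → ≤-trans (reflexive (f≈g i)) (⋁-upper g i))
    (⋁-lub g (⋁ f) λ i → ≤-trans (reflexive (Eq.sym (f≈g i))) (⋁-upper f i))

  ⇨-mp : ∀ {d a b} → d ≤ a ⇨ b → d ≤ a → d ≤ b
  ⇨-mp d≤a⇨b d≤a = ≤-trans (∧-greatest d≤a⇨b d≤a) ⇨-eval

  ∨-elim : ∀ {d a b x} → d ≤ a ∨ b → d ∧ a ≤ x → d ∧ b ≤ x → d ≤ x
  ∨-elim d≤a∨b da≤x db≤x =
    ⇨-mp (≤-trans d≤a∨b (∨-least (swap-transpose-⇨ da≤x) (swap-transpose-⇨ db≤x))) ≤-refl

  ⋁-elim : ∀ {I : Set} {d x} (f : I → Carrier) → d ≤ ⋁ f → (∀ i → d ∧ f i ≤ x) → d ≤ x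
  ⋁-elim f d≤⋁f dfi≤x = ⇨-mp (≤-trans d≤⋁f (⋁-lub f _ (swap-transpose-⇨ ∘ dfi≤x))) ≤-refl

  ∧-weaken : ∀ {d x y} → d ≤ y → d ∧ x ≤ y
  ∧-weaken = ≤-trans (x∧y≤x _ _)

  ⋀-instance : ∀ {I : Set} {d} {f : I → Carrier} → d ≤ ⋀ f → ∀ i → d ≤ f i
  ⋀-instance {f = f} d≤⋀f i = ≤-trans d≤⋀f (⋀-lower f i)

  ⊤≤⇨-mp : ∀ {d a b} → ⊤ ≤ a ⇨ b → d ≤ a → d ≤ b
  ⊤≤⇨-mp ⊤≤a⇨b = ⇨-mp (≤-trans (maximum _) ⊤≤a⇨b)

  ≈⇒⊤≤⇔ : ∀ {a b} → a ≈ b → ⊤ ≤ (a ⇨ b) ∧ (b ⇨ a)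
  ≈⇒⊤≤⇔ a≈b = ∧-greatest (transpose-⇨ (≤-trans (x∧y≤y _ _) (reflexive a≈b)))
                       (transpose-⇨ (≤-trans (x∧y≤y _ _) (reflexive (Eq.sym a≈b))))

ext-∷ : ∀ {A : Set} {n n'} {π : Fin n → Fin n'} {ρ : Vector A n'} {ρ' : Vector A n}
        (a : A) → ρ ∘ π ≗ ρ' → (a ∷ ρ) ∘ ext π ≗ a ∷ ρ'
ext-∷ a ρπ≗ρ' zero    = refl
ext-∷ a ρπ≗ρ' (suc i) = ρπ≗ρ' i

ext-∘ : ∀ {n n' n''} {π : Fin n' → Fin n''} {θ : Fin n → Fin n'} {χ : Fin n → Fin n''} →
        π ∘ θ ≗ χ → ext π ∘ ext θ ≗ ext χ
ext-∘ πθ≗χ zero    = refl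
ext-∘ πθ≗χ (suc i) = cong suc (πθ≗χ i)

ren-ren : ∀ {n n' n''} {π : Fin n' → Fin n''} {θ : Fin n → Fin n'} {χ : Fin n → Fin n''}
          (φ : Fm n) → π ∘ θ ≗ χ → ren π (ren θ φ) ≡ ren χ φ
ren-ren (i ≐ j) πθ≗χ = cong₂ _≐_ (πθ≗χ i) (πθ≗χ j)
ren-ren (i ∈̇ j) πθ≗χ = cong₂ _∈̇_ (πθ≗χ i) (πθ≗χ j)
ren-ren ⊥̇       πθ≗χ = refl
ren-ren (φ ∧̇ ψ) πθ≗χ = cong₂ _∧̇_ (ren-ren φ πθ≗χ) (ren-ren ψ πθ≗χ)
ren-ren (φ ∨̇ ψ) πθ≗χ = cong₂ _∨̇_ (ren-ren φ πθ≗χ) (ren-ren ψ πθ≗χ)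
ren-ren (φ ⇒̇ ψ) πθ≗χ = cong₂ _⇒̇_ (ren-ren φ πθ≗χ) (ren-ren ψ πθ≗χ)
ren-ren (∀̇ φ)   πθ≗χ = cong ∀̇ (ren-ren φ (ext-∘ πθ≗χ))
ren-ren (∃̇ φ)   πθ≗χ = cong ∃̇ (ren-ren φ (ext-∘ πθ≗χ))

ren2-noClassQ : ∀ {n n' m m'} (π : Fin n → Fin n') (τ : Fin m → Fin m') {φ : Fm2 n m} →
                NoClassQ φ → NoClassQ (ren2 π τ φ)
ren2-noClassQ π τ (eq i j)  = eq (π i) (π j)
ren2-noClassQ π τ (el i j)  = el (π i) (π j)
ren2-noClassQ π τ (mb i p)  = mb (π i) (τ p)
ren2-noClassQ π τ bot       = bot
ren2-noClassQ π τ (and φ ψ) = and (ren2-noClassQ π τ φ) (ren2-noClassQ π τ ψ)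
ren2-noClassQ π τ (or φ ψ)  = or (ren2-noClassQ π τ φ) (ren2-noClassQ π τ ψ)
ren2-noClassQ π τ (imp φ ψ) = imp (ren2-noClassQ π τ φ) (ren2-noClassQ π τ ψ)
ren2-noClassQ π τ (all φ)   = all (ren2-noClassQ (ext π) τ φ)
ren2-noClassQ π τ (ex φ)    = ex (ren2-noClassQ (ext π) τ φ)

SE2-body : ∀ {k m} → Fm2 (suc (suc k)) m → Fm2 (suc (suc k)) m
SE2-body R =
  (ren2 (pick (# 1) (# 0) (2 ↑ʳ_)) id R
   ∧̇ ∀s (∀s (∀s (
        (# 1 ∈̇ # 2 ∧̇ ren2 (pick (# 2) (# 0) (5 ↑ʳ_)) id R)
        ⇒̇ ∃s (# 0 ∈̇ # 1 ∧̇ ren2 (pick (# 2) (# 0) (6 ↑ʳ_)) id R))))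
   ∧̇ ∀s (∀s (∀s (
        (# 1 ∈̇ # 2 ∧̇ ren2 (pick (# 0) (# 2) (5 ↑ʳ_)) id R)
        ⇒̇ ∃s (# 0 ∈̇ # 1 ∧̇ ren2 (pick (# 0) (# 2) (6 ↑ʳ_)) id R)))))
  ⇒̇ # 1 ≐ # 0

RC2-body : ∀ {k m} → Fm2 (suc (suc k)) m → Fm2 (suc (suc (suc k))) m
RC2-body P = # 0 ∈̇ # 1 ⇔₂ (# 0 ∈̇ # 2 ∧̇ ren2 (pick (# 0) (# 2) (3 ↑ʳ_)) id P)

SE2-body-noClassQ : ∀ {k m} {R : Fm2 (suc (suc k)) m} → NoClassQ R → NoClassQ (SE2-body R)
SE2-body-noClassQ {k} {m} {R} R-nq =
  imp (and (R' _) (and (forth (R' _) (R' _)) (forth (R' _) (R' _)))) (eq _ _)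
  where
    R' : ∀ {n} (π : Fin (suc (suc k)) → Fin n) → NoClassQ (ren2 π id R)
    R' π = ren2-noClassQ π id R-nq
    forth : ∀ {n} {φ : Fm2 (3 + n) m} {ψ : Fm2 (4 + n) m} → NoClassQ φ → NoClassQ ψ →
            NoClassQ (∀s (∀s (∀s ((# 1 ∈̇ # 2 ∧̇ φ) ⇒̇ ∃s (# 0 ∈̇ # 1 ∧̇ ψ)))))
    forth φ ψ = all (all (all (imp (and (el _ _) φ) (ex (and (el _ _) ψ)))))

RC2-body-noClassQ : ∀ {k m} {P : Fm2 (suc (suc k)) m} → NoClassQ P → NoClassQ (RC2-body P)
RC2-body-noClassQ P-nq = and (imp (el _ _) (and (el _ _) P')) (imp (and (el _ _) P') (el _ _))
  where P' = ren2-noClassQ (pick (# 0) (# 2) (3 ↑ʳ_)) id P-nq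

-- Given a formula Q p for each class variable p, all with the same K
-- parameters, mem (i , p) is replaced by Q p applied to variable i; the
-- parameters become K further free variables after the set variables.
-- Class quantifiers, excluded by NoClassQ, are sent to ⊥̇.
module ClassElimination {m K : ℕ} (Q : Fin m → Fm (suc K)) where

  at : ∀ {n} → Fin n → Fin (suc K) → Fin (n + K)
  at i zero        = i ↑ˡ K
  at {n} i (suc l) = n ↑ʳ l

  elimClasses : ∀ {n} → Fm2 n m → Fm (n + K)
  elimClasses (i ≐ j)   = (i ↑ˡ K) ≐ (j ↑ˡ K)
  elimClasses (i ∈̇ j)   = (i ↑ˡ K) ∈̇ (j ↑ˡ K)
  elimClasses (mem i p) = ren (at i) (Q p)
  elimClasses ⊥̇         = ⊥̇
  elimClasses (φ ∧̇ ψ)   = elimClasses φ ∧̇ elimClasses ψ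
  elimClasses (φ ∨̇ ψ)   = elimClasses φ ∨̇ elimClasses ψ
  elimClasses (φ ⇒̇ ψ)   = elimClasses φ ⇒̇ elimClasses ψ
  elimClasses (∀s φ)    = ∀̇ (elimClasses φ)
  elimClasses (∃s φ)    = ∃̇ (elimClasses φ)
  elimClasses (∀c φ)    = ⊥̇
  elimClasses (∃c φ)    = ⊥̇

  ext-↑ˡ : ∀ {n n'} {π : Fin n → Fin n'} {π' : Fin (n + K) → Fin (n' + K)} →
           (∀ i → π' (i ↑ˡ K) ≡ π i ↑ˡ K) → ∀ i → ext π' (i ↑ˡ K) ≡ ext π i ↑ˡ K
  ext-↑ˡ π'ˡ zero    = refl
  ext-↑ˡ π'ˡ (suc i) = cong suc (π'ˡ i)

  elimClasses-ren2 : ∀ {n n'} (π : Fin n → Fin n') {π' : Fin (n + K) → Fin (n' + K)}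
                     (φ : Fm2 n m) →
                     (∀ i → π' (i ↑ˡ K) ≡ π i ↑ˡ K) → (∀ l → π' (n ↑ʳ l) ≡ n' ↑ʳ l) →
                     elimClasses (ren2 π id φ) ≡ ren π' (elimClasses φ)
  elimClasses-ren2 π (i ≐ j) π'ˡ π'ʳ = cong₂ _≐_ (sym (π'ˡ i)) (sym (π'ˡ j))
  elimClasses-ren2 π (i ∈̇ j) π'ˡ π'ʳ = cong₂ _∈̇_ (sym (π'ˡ i)) (sym (π'ˡ j))
  elimClasses-ren2 π (mem i p) π'ˡ π'ʳ =
    sym (ren-ren (Q p) λ { zero → π'ˡ i ; (suc l) → π'ʳ l })
  elimClasses-ren2 π ⊥̇ π'ˡ π'ʳ = refl
  elimClasses-ren2 π (φ ∧̇ ψ) π'ˡ π'ʳ =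
    cong₂ _∧̇_ (elimClasses-ren2 π φ π'ˡ π'ʳ) (elimClasses-ren2 π ψ π'ˡ π'ʳ)
  elimClasses-ren2 π (φ ∨̇ ψ) π'ˡ π'ʳ =
    cong₂ _∨̇_ (elimClasses-ren2 π φ π'ˡ π'ʳ) (elimClasses-ren2 π ψ π'ˡ π'ʳ)
  elimClasses-ren2 π (φ ⇒̇ ψ) π'ˡ π'ʳ =
    cong₂ _⇒̇_ (elimClasses-ren2 π φ π'ˡ π'ʳ) (elimClasses-ren2 π ψ π'ˡ π'ʳ)
  elimClasses-ren2 π (∀s φ) π'ˡ π'ʳ =
    cong ∀̇ (elimClasses-ren2 (ext π) φ (ext-↑ˡ π'ˡ) (cong suc ∘ π'ʳ))
  elimClasses-ren2 π (∃s φ) π'ˡ π'ʳ =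
    cong ∃̇ (elimClasses-ren2 (ext π) φ (ext-↑ˡ π'ˡ) (cong suc ∘ π'ʳ))
  elimClasses-ren2 π (∀c φ) π'ˡ π'ʳ = refl
  elimClasses-ren2 π (∃c φ) π'ˡ π'ʳ = refl

  -- s ↑ʳ_, typed with (s + k) + K instead of s + (k + K).
  weaken : ∀ {k} (s : ℕ) → Fin (k + K) → Fin (s + k + K)
  weaken zero    y = y
  weaken (suc s) y = suc (weaken s y)

  elimClasses-pick : ∀ {k} (s : ℕ) (i j : Fin (s + k)) (R : Fm2 (suc (suc k)) m) →
                     elimClasses (ren2 (pick i j (s ↑ʳ_)) id R)
                       ≡ ren (pick (i ↑ˡ K) (j ↑ˡ K) (weaken s)) (elimClasses R)
  elimClasses-pick {k} s i j R = elimClasses-ren2 (pick i j (s ↑ʳ_)) R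
    (λ { zero → refl ; (suc zero) → refl ; (suc (suc l)) → weaken-↑ˡ s l })
    (weaken-↑ʳ s)
    where
      weaken-↑ˡ : ∀ s (l : Fin k) → weaken s (l ↑ˡ K) ≡ (s ↑ʳ l) ↑ˡ K
      weaken-↑ˡ zero    l = refl
      weaken-↑ˡ (suc s) l = cong suc (weaken-↑ˡ s l)
      weaken-↑ʳ : ∀ s (l : Fin K) → weaken {k} s (k ↑ʳ l) ≡ (s + k) ↑ʳ l
      weaken-↑ʳ zero    l = refl
      weaken-↑ʳ (suc s) l = cong suc (weaken-↑ʳ s l)

  elimClasses-SE2-body : ∀ {k} (R : Fm2 (suc (suc k)) m) →
                         elimClasses (SE2-body R) ≡ SE-body (elimClasses R)
  elimClasses-SE2-body R
    rewrite elimClasses-pick 2 (# 1) (# 0) R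
          | elimClasses-pick 5 (# 2) (# 0) R | elimClasses-pick 6 (# 2) (# 0) R
          | elimClasses-pick 5 (# 0) (# 2) R | elimClasses-pick 6 (# 0) (# 2) R = refl

  elimClasses-RC2-body : ∀ {k} (P : Fm2 (suc (suc k)) m) →
                         elimClasses (RC2-body P)
                           ≡ (# 0 ∈̇ # 1 ⇔̇
                               (# 0 ∈̇ # 2 ∧̇ ren (pick (# 0) (# 2) (3 ↑ʳ_)) (elimClasses P)))
  elimClasses-RC2-body P rewrite elimClasses-pick 3 (# 0) (# 2) P = refl

module Semantics {B : CompleteHeytingAlgebra} (M : ZStructure B) where
  open CompleteHeytingAlgebra B renaming (refl to ≤-refl; trans to ≤-trans)
  open CompleteHeytingAlgebraProperties B
  open ZStructure M

  Class : Set
  Class = Z2Structure.ClassDom (M' M)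

  ⟦_⟧ᴹ : ∀ {n} → Fm n → Vector Dom n → Carrier
  ⟦_⟧ᴹ = ⟦_⟧ M

  ⟦_⟧′ : ∀ {n m} → Fm2 n m → Vector Dom n → Vector Class m → Carrier
  ⟦_⟧′ = ⟦_⟧₂ (M' M)

  ⟦ren⟧ : ∀ {n n'} (π : Fin n → Fin n') (φ : Fm n) {ρ : Vector Dom n'} {ρ' : Vector Dom n} →
          ρ ∘ π ≗ ρ' → ⟦ ren π φ ⟧ᴹ ρ ≈ ⟦ φ ⟧ᴹ ρ'
  ⟦ren⟧ π (i ≐ j) ρπ≗ρ' = Eq.reflexive (cong₂ eqᴮ (ρπ≗ρ' i) (ρπ≗ρ' j))
  ⟦ren⟧ π (i ∈̇ j) ρπ≗ρ' = Eq.reflexive (cong₂ memᴮ (ρπ≗ρ' i) (ρπ≗ρ' j))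
  ⟦ren⟧ π ⊥̇       ρπ≗ρ' = Eq.refl
  ⟦ren⟧ π (φ ∧̇ ψ) ρπ≗ρ' = ∧-cong (⟦ren⟧ π φ ρπ≗ρ') (⟦ren⟧ π ψ ρπ≗ρ')
  ⟦ren⟧ π (φ ∨̇ ψ) ρπ≗ρ' = ∨-cong (⟦ren⟧ π φ ρπ≗ρ') (⟦ren⟧ π ψ ρπ≗ρ')
  ⟦ren⟧ π (φ ⇒̇ ψ) ρπ≗ρ' = ⇨-cong (⟦ren⟧ π φ ρπ≗ρ') (⟦ren⟧ π ψ ρπ≗ρ')
  ⟦ren⟧ π (∀̇ φ)   ρπ≗ρ' = ⋀-cong λ a → ⟦ren⟧ (ext π) φ (ext-∷ a ρπ≗ρ')
  ⟦ren⟧ π (∃̇ φ)   ρπ≗ρ' = ⋁-cong λ a → ⟦ren⟧ (ext π) φ (ext-∷ a ρπ≗ρ')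

  ⟦⟧-resp-≗ : ∀ {n} (φ : Fm n) {ρ ρ' : Vector Dom n} → ρ ≗ ρ' → ⟦ φ ⟧ᴹ ρ ≈ ⟦ φ ⟧ᴹ ρ'
  ⟦⟧-resp-≗ (i ≐ j) ρ≗ρ' = Eq.reflexive (cong₂ eqᴮ (ρ≗ρ' i) (ρ≗ρ' j))
  ⟦⟧-resp-≗ (i ∈̇ j) ρ≗ρ' = Eq.reflexive (cong₂ memᴮ (ρ≗ρ' i) (ρ≗ρ' j))
  ⟦⟧-resp-≗ ⊥̇       ρ≗ρ' = Eq.refl
  ⟦⟧-resp-≗ (φ ∧̇ ψ) ρ≗ρ' = ∧-cong (⟦⟧-resp-≗ φ ρ≗ρ') (⟦⟧-resp-≗ ψ ρ≗ρ')
  ⟦⟧-resp-≗ (φ ∨̇ ψ) ρ≗ρ' = ∨-cong (⟦⟧-resp-≗ φ ρ≗ρ') (⟦⟧-resp-≗ ψ ρ≗ρ')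
  ⟦⟧-resp-≗ (φ ⇒̇ ψ) ρ≗ρ' = ⇨-cong (⟦⟧-resp-≗ φ ρ≗ρ') (⟦⟧-resp-≗ ψ ρ≗ρ')
  ⟦⟧-resp-≗ (∀̇ φ)   ρ≗ρ' = ⋀-cong λ a → ⟦⟧-resp-≗ φ (∷-cong refl ρ≗ρ')
  ⟦⟧-resp-≗ (∃̇ φ)   ρ≗ρ' = ⋁-cong λ a → ⟦⟧-resp-≗ φ (∷-cong refl ρ≗ρ')

  close-instance : ∀ k (φ : Fm k) {ρ₀ : Vector Dom 0} → ⊤ ≤ ⟦ close k φ ⟧ᴹ ρ₀ →
                ∀ ρ → ⊤ ≤ ⟦ φ ⟧ᴹ ρ
  close-instance zero    φ valid ρ = ≤-trans valid (reflexive (⟦⟧-resp-≗ φ λ ()))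
  close-instance (suc k) φ valid ρ = ≤-trans
    (≤-trans (close-instance k (∀̇ φ) valid (ρ ∘ suc)) (⋀-lower _ (ρ zero)))
    (reflexive (⟦⟧-resp-≗ φ λ { zero → refl ; (suc i) → refl }))

  ⟦emb⟧ : ∀ {n m} (φ : Fm n) (ρ : Vector Dom n) (σ : Vector Class m) →
          ⟦ emb φ ⟧′ ρ σ ≈ ⟦ φ ⟧ᴹ ρ
  ⟦emb⟧ (i ≐ j) ρ σ = Eq.refl
  ⟦emb⟧ (i ∈̇ j) ρ σ = Eq.refl
  ⟦emb⟧ ⊥̇       ρ σ = Eq.refl
  ⟦emb⟧ (φ ∧̇ ψ) ρ σ = ∧-cong (⟦emb⟧ φ ρ σ) (⟦emb⟧ ψ ρ σ)
  ⟦emb⟧ (φ ∨̇ ψ) ρ σ = ∨-cong (⟦emb⟧ φ ρ σ) (⟦emb⟧ ψ ρ σ)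
  ⟦emb⟧ (φ ⇒̇ ψ) ρ σ = ⇨-cong (⟦emb⟧ φ ρ σ) (⟦emb⟧ ψ ρ σ)
  ⟦emb⟧ (∀̇ φ)   ρ σ = ⋀-cong λ a → ⟦emb⟧ φ (a ∷ ρ) σ
  ⟦emb⟧ (∃̇ φ)   ρ σ = ⋁-cong λ a → ⟦emb⟧ φ (a ∷ ρ) σ

  ⟦ren2⟧ : ∀ {n n' m m'} (π : Fin n → Fin n') (τ : Fin m → Fin m') (φ : Fm2 n m)
           {ρ : Vector Dom n'} {ρ' : Vector Dom n} {σ : Vector Class m'} {σ' : Vector Class m} →
           ρ ∘ π ≗ ρ' → σ ∘ τ ≗ σ' → ⟦ ren2 π τ φ ⟧′ ρ σ ≈ ⟦ φ ⟧′ ρ' σ'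
  ⟦ren2⟧ π τ (i ≐ j)   ρπ≗ρ' στ≗σ' = Eq.reflexive (cong₂ eqᴮ (ρπ≗ρ' i) (ρπ≗ρ' j))
  ⟦ren2⟧ π τ (i ∈̇ j)   ρπ≗ρ' στ≗σ' = Eq.reflexive (cong₂ memᴮ (ρπ≗ρ' i) (ρπ≗ρ' j))
  ⟦ren2⟧ π τ (mem i p) ρπ≗ρ' στ≗σ' =
    Eq.reflexive (cong₂ (λ a E → proj₁ E a) (ρπ≗ρ' i) (στ≗σ' p))
  ⟦ren2⟧ π τ ⊥̇         ρπ≗ρ' στ≗σ' = Eq.refl
  ⟦ren2⟧ π τ (φ ∧̇ ψ)   ρπ≗ρ' στ≗σ' =
    ∧-cong (⟦ren2⟧ π τ φ ρπ≗ρ' στ≗σ') (⟦ren2⟧ π τ ψ ρπ≗ρ' στ≗σ')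
  ⟦ren2⟧ π τ (φ ∨̇ ψ)   ρπ≗ρ' στ≗σ' =
    ∨-cong (⟦ren2⟧ π τ φ ρπ≗ρ' στ≗σ') (⟦ren2⟧ π τ ψ ρπ≗ρ' στ≗σ')
  ⟦ren2⟧ π τ (φ ⇒̇ ψ)   ρπ≗ρ' στ≗σ' =
    ⇨-cong (⟦ren2⟧ π τ φ ρπ≗ρ' στ≗σ') (⟦ren2⟧ π τ ψ ρπ≗ρ' στ≗σ')
  ⟦ren2⟧ π τ (∀s φ)    ρπ≗ρ' στ≗σ' = ⋀-cong λ a → ⟦ren2⟧ (ext π) τ φ (ext-∷ a ρπ≗ρ') στ≗σ'
  ⟦ren2⟧ π τ (∃s φ)    ρπ≗ρ' στ≗σ' = ⋁-cong λ a → ⟦ren2⟧ (ext π) τ φ (ext-∷ a ρπ≗ρ') στ≗σ'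
  ⟦ren2⟧ π τ (∀c φ)    ρπ≗ρ' στ≗σ' = ⋀-cong λ E → ⟦ren2⟧ π (ext τ) φ ρπ≗ρ' (ext-∷ E στ≗σ')
  ⟦ren2⟧ π τ (∃c φ)    ρπ≗ρ' στ≗σ' = ⋁-cong λ E → ⟦ren2⟧ π (ext τ) φ ρπ≗ρ' (ext-∷ E στ≗σ')

  closeS-valid : ∀ {m} k (φ : Fm2 k m) {σ : Vector Class m} →
                 (∀ ρ → ⊤ ≤ ⟦ φ ⟧′ ρ σ) → ∀ ρ₀ → ⊤ ≤ ⟦ closeS k φ ⟧′ ρ₀ σ
  closeS-valid zero    φ valid ρ₀ = valid ρ₀
  closeS-valid (suc k) φ valid ρ₀ =
    closeS-valid k (∀s φ) (λ ρ → ⋀-glb _ _ λ a → valid (a ∷ ρ)) ρ₀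

  closeC-valid : ∀ m (φ : Fm2 0 m) {ρ₀ : Vector Dom 0} →
                 (∀ σ → ⊤ ≤ ⟦ φ ⟧′ ρ₀ σ) → ∀ σ₀ → ⊤ ≤ ⟦ closeC m φ ⟧′ ρ₀ σ₀
  closeC-valid zero    φ valid σ₀ = valid σ₀
  closeC-valid (suc m) φ valid σ₀ =
    closeC-valid m (∀c φ) (λ σ → ⋀-glb _ _ λ E → valid (E ∷ σ)) σ₀

  closure-valid : ∀ k m (φ : Fm2 k m) → (∀ ρ σ → ⊤ ≤ ⟦ φ ⟧′ ρ σ) →
                  ∀ ρ₀ σ₀ → ⊤ ≤ ⟦ closeC m (closeS k φ) ⟧′ ρ₀ σ₀
  closure-valid k m φ valid ρ₀ =
    closeC-valid m (closeS k φ) (λ σ → closeS-valid k φ (λ ρ → valid ρ σ) ρ₀)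

  record JointDefinition {m} (σ : Vector Class m) : Set where
    field
      K       : ℕ
      Q       : Fin m → Fm (suc K)
      c       : Vector Dom K
      defines : ∀ p a → ⟦ Q p ⟧ᴹ (a ∷ c) ≈ proj₁ (σ p) a

  jointDefinition : ∀ {m} (σ : Vector Class m) → JointDefinition σ
  jointDefinition {zero} σ = record { K = 0 ; Q = λ () ; c = λ () ; defines = λ () }
  jointDefinition {suc m} σ = extend (proj₂ (σ zero)) (jointDefinition (σ ∘ suc))
    where
      extend : Definable M (proj₁ (σ zero)) → JointDefinition (σ ∘ suc) → JointDefinition σ
      extend (n , P , b , P-defines) record { K = K ; Q = Q ; c = c ; defines = Q-defines } =
        record { K = n + K ; Q = Q′ ; c = b ++ c ; defines = defines′ }
        where
          Q′ : Fin (suc m) → Fm (suc (n + K))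
          Q′ zero    = ren (ext (_↑ˡ K)) P
          Q′ (suc p) = ren (ext (n ↑ʳ_)) (Q p)
          defines′ : ∀ p a → ⟦ Q′ p ⟧ᴹ (a ∷ (b ++ c)) ≈ proj₁ (σ p) a
          defines′ zero    a = Eq.trans (⟦ren⟧ _ P (ext-∷ a (lookup-++ˡ b c))) (P-defines a)
          defines′ (suc p) a = Eq.trans (⟦ren⟧ _ (Q p) (ext-∷ a (lookup-++ʳ b c))) (Q-defines p a)

  module _ {m} {σ : Vector Class m} (J : JointDefinition σ) where
    open JointDefinition J
    open ClassElimination Q

    ⟦elimClasses⟧ : ∀ {n} (φ : Fm2 n m) → NoClassQ φ →
                    {e : Vector Dom (n + K)} {ρ : Vector Dom n} →
                    (∀ i → e (i ↑ˡ K) ≡ ρ i) → (∀ l → e (n ↑ʳ l) ≡ c l) →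
                    ⟦ elimClasses φ ⟧ᴹ e ≈ ⟦ φ ⟧′ ρ σ
    ⟦elimClasses⟧ (i ≐ j) _ eˡ eʳ = Eq.reflexive (cong₂ eqᴮ (eˡ i) (eˡ j))
    ⟦elimClasses⟧ (i ∈̇ j) _ eˡ eʳ = Eq.reflexive (cong₂ memᴮ (eˡ i) (eˡ j))
    ⟦elimClasses⟧ (mem i p) _ eˡ eʳ =
      Eq.trans (⟦ren⟧ (at i) (Q p) λ { zero → eˡ i ; (suc l) → eʳ l }) (defines p _)
    ⟦elimClasses⟧ ⊥̇ _ eˡ eʳ = Eq.refl
    ⟦elimClasses⟧ (φ ∧̇ ψ) (and φ-nq ψ-nq) eˡ eʳ =
      ∧-cong (⟦elimClasses⟧ φ φ-nq eˡ eʳ) (⟦elimClasses⟧ ψ ψ-nq eˡ eʳ)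
    ⟦elimClasses⟧ (φ ∨̇ ψ) (or φ-nq ψ-nq) eˡ eʳ =
      ∨-cong (⟦elimClasses⟧ φ φ-nq eˡ eʳ) (⟦elimClasses⟧ ψ ψ-nq eˡ eʳ)
    ⟦elimClasses⟧ (φ ⇒̇ ψ) (imp φ-nq ψ-nq) eˡ eʳ =
      ⇨-cong (⟦elimClasses⟧ φ φ-nq eˡ eʳ) (⟦elimClasses⟧ ψ ψ-nq eˡ eʳ)
    ⟦elimClasses⟧ (∀s φ) (all φ-nq) eˡ eʳ =
      ⋀-cong λ a → ⟦elimClasses⟧ φ φ-nq (∷-cong refl eˡ) eʳ
    ⟦elimClasses⟧ (∃s φ) (ex φ-nq) eˡ eʳ =
      ⋁-cong λ a → ⟦elimClasses⟧ φ φ-nq (∷-cong refl eˡ) eʳ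

module Validity {B : CompleteHeytingAlgebra} (M : ZStructure B) (model : IsZstModel M) where
  open CompleteHeytingAlgebra B renaming (refl to ≤-refl; trans to ≤-trans)
  open CompleteHeytingAlgebraProperties B
  open ZStructure M
  open Semantics M

  Zst-axiom-valid : ∀ {φ} → AxZst φ → ∀ ρ → ⊤ ≤ ⟦ φ ⟧ᴹ ρ
  Zst-axiom-valid {φ} ax ρ =
    ≤-trans (reflexive (Eq.sym (model φ ax))) (reflexive (⟦⟧-resp-≗ φ λ ()))

  Zst-axiom-valid₃ : ∀ {φ : Fm 3} → AxZst (∀̇ (∀̇ (∀̇ φ))) → ∀ x y z → ⊤ ≤ ⟦ φ ⟧ᴹ (z ∷ y ∷ x ∷ λ ())
  Zst-axiom-valid₃ ax x y z = ⋀-instance (⋀-instance (⋀-instance (Zst-axiom-valid ax (λ ())) x) y) z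

  eq-refl : ∀ a → ⊤ ≤ eqᴮ a a
  eq-refl = ⋀-instance (Zst-axiom-valid eqRefl (λ ()))

  eq-sym : ∀ {d a b} → d ≤ eqᴮ a b → d ≤ eqᴮ b a
  eq-sym {a = a} {b} d≤a=b = ⊤≤⇨-mp (Zst-axiom-valid₃ eqTrans a b a)
    (∧-greatest d≤a=b (≤-trans (maximum _) (eq-refl a)))

  eq-trans : ∀ {d a b c} → d ≤ eqᴮ a b → d ≤ eqᴮ b c → d ≤ eqᴮ a c
  eq-trans {a = a} {b} {c} d≤a=b d≤b=c =
    ⊤≤⇨-mp (Zst-axiom-valid₃ eqTrans b a c)
      (∧-greatest (eq-sym d≤a=b) d≤b=c)

  ∈-substˡ : ∀ {d a a' b} → d ≤ eqᴮ a a' → d ≤ memᴮ a b → d ≤ memᴮ a' b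
  ∈-substˡ {a = a} {a'} {b} d≤a=a' d≤a∈b =
    ⊤≤⇨-mp (Zst-axiom-valid₃ eqMemL a a' b)
      (∧-greatest d≤a=a' d≤a∈b)

  ∈-substʳ : ∀ {d a b b'} → d ≤ eqᴮ b b' → d ≤ memᴮ a b → d ≤ memᴮ a b'
  ∈-substʳ {a = a} {b} {b'} d≤b=b' d≤a∈b =
    ⊤≤⇨-mp (Zst-axiom-valid₃ eqMemR a b b')
      (∧-greatest d≤b=b' d≤a∈b)

  ⟦⟧-subst : ∀ {n} (φ : Fm n) {ρ ρ' : Vector Dom n} {d} →
             (∀ j → d ≤ eqᴮ (ρ j) (ρ' j)) → d ≤ ⟦ φ ⟧ᴹ ρ → d ≤ ⟦ φ ⟧ᴹ ρ'
  ⟦⟧-subst (i ≐ j) ρ=ρ' d≤φ = eq-trans (eq-sym (ρ=ρ' i)) (eq-trans d≤φ (ρ=ρ' j))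
  ⟦⟧-subst (i ∈̇ j) ρ=ρ' d≤φ = ∈-substʳ (ρ=ρ' j) (∈-substˡ (ρ=ρ' i) d≤φ)
  ⟦⟧-subst ⊥̇       ρ=ρ' d≤φ = d≤φ
  ⟦⟧-subst (φ ∧̇ ψ) ρ=ρ' d≤φ∧ψ = ∧-greatest
    (⟦⟧-subst φ ρ=ρ' (≤-trans d≤φ∧ψ (x∧y≤x _ _)))
    (⟦⟧-subst ψ ρ=ρ' (≤-trans d≤φ∧ψ (x∧y≤y _ _)))
  ⟦⟧-subst (φ ∨̇ ψ) ρ=ρ' d≤φ∨ψ = ∨-elim d≤φ∨ψ
    (≤-trans (⟦⟧-subst φ (λ j → ∧-weaken (ρ=ρ' j)) (x∧y≤y _ _)) (x≤x∨y _ _))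
    (≤-trans (⟦⟧-subst ψ (λ j → ∧-weaken (ρ=ρ' j)) (x∧y≤y _ _)) (y≤x∨y _ _))
  ⟦⟧-subst (φ ⇒̇ ψ) ρ=ρ' d≤φ⇒ψ = transpose-⇨ (⟦⟧-subst ψ (λ j → ∧-weaken (ρ=ρ' j))
    (⇨-mp (∧-weaken d≤φ⇒ψ) (⟦⟧-subst φ (λ j → eq-sym (∧-weaken (ρ=ρ' j))) (x∧y≤y _ _))))
  ⟦⟧-subst (∀̇ φ) ρ=ρ' d≤∀φ = ⋀-glb _ _ λ a →
    ⟦⟧-subst φ (λ { zero → ≤-trans (maximum _) (eq-refl a) ; (suc j) → ρ=ρ' j })
      (⋀-instance d≤∀φ a)
  ⟦⟧-subst (∃̇ φ) ρ=ρ' d≤∃φ = ⋁-elim _ d≤∃φ λ a → ≤-trans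
    (⟦⟧-subst φ (λ { zero → ≤-trans (maximum _) (eq-refl a)
                   ; (suc j) → ∧-weaken (ρ=ρ' j) })
      (x∧y≤y _ _))
    (⋁-upper _ a)

  class-resp-eq : ∀ (E : Class) a b → eqᴮ a b ∧ proj₁ E a ≤ proj₁ E b
  class-resp-eq (_ , _ , P , params , P-defines) a b = ≤-trans
    (⟦⟧-subst P (λ { zero → x∧y≤x _ _ ; (suc j) → ≤-trans (maximum _) (eq-refl (params j)) })
      (≤-trans (x∧y≤y _ _) (reflexive (Eq.sym (P-defines a)))))
    (reflexive (P-defines b))

  emb-valid : ∀ {φ m} → AxZst φ → ∀ ρ (σ : Vector Class m) → ⊤ ≤ ⟦ emb φ ⟧′ ρ σ
  emb-valid {φ} ax ρ σ = ≤-trans (Zst-axiom-valid ax ρ) (reflexive (Eq.sym (⟦emb⟧ φ ρ σ)))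

  memEq-valid : ∀ ρ σ → ⊤ ≤ ⟦ MemEq ⟧′ ρ σ
  memEq-valid ρ σ = ⋀-glb _ _ λ a → ⋀-glb _ _ λ b → ⋀-glb _ _ λ E →
    transpose-⇨ (≤-trans (x∧y≤y _ _) (class-resp-eq E a b))

  transfer : ∀ {k m} (ψ : Fm2 k m) → NoClassQ ψ →
             (∀ {K} (Q : Fin m → Fm (suc K)) ρ → ⊤ ≤ ⟦ ClassElimination.elimClasses Q ψ ⟧ᴹ ρ) →
             ∀ ρ σ → ⊤ ≤ ⟦ ψ ⟧′ ρ σ
  transfer ψ ψ-nq elim-valid ρ σ = ≤-trans (elim-valid Q (ρ ++ c))
    (reflexive (⟦elimClasses⟧ J ψ ψ-nq (lookup-++ˡ ρ c) (lookup-++ʳ ρ c)))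
    where
      J = jointDefinition σ
      open JointDefinition J

  strongExt-valid : ∀ k m (R : Fm2 (suc (suc k)) m) → NoClassQ R →
                    ∀ ρ σ → ⊤ ≤ ⟦ SE2 k m R ⟧′ ρ σ
  strongExt-valid k m R R-nq = closure-valid k m _ (transfer (∀s (∀s (SE2-body R)))
    (all (all (SE2-body-noClassQ R-nq))) λ {K} Q ρ → let open ClassElimination Q in
      subst (λ φ → ⊤ ≤ ⟦ ∀̇ (∀̇ φ) ⟧ᴹ ρ) (sym (elimClasses-SE2-body R))
        (close-instance (k + K) _ (Zst-axiom-valid (strongExt (k + K) (elimClasses R)) (λ ())) ρ))

  restrComp-valid : ∀ k m (P : Fm2 (suc (suc k)) m) → NoClassQ P →
                    ∀ ρ σ → ⊤ ≤ ⟦ RC2 k m P ⟧′ ρ σ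
  restrComp-valid k m P P-nq = closure-valid k m _ (transfer (∀s (∃s (∀s (RC2-body P))))
    (all (ex (all (RC2-body-noClassQ P-nq)))) λ {K} Q ρ → let open ClassElimination Q in
      subst (λ φ → ⊤ ≤ ⟦ ∀̇ (∃̇ (∀̇ φ)) ⟧ᴹ ρ) (sym (elimClasses-RC2-body P))
        (close-instance (k + K) _ (Zst-axiom-valid (restrComp (k + K) (elimClasses P)) (λ ())) ρ))

  classComp-valid : ∀ k m (P : Fm2 (suc k) m) → NoClassQ P →
                    ∀ ρ σ → ⊤ ≤ ⟦ CC k m P ⟧′ ρ σ
  classComp-valid k m P P-nq = closure-valid k m _ witness
    where
      witness : ∀ ρ σ → ⊤ ≤ ⟦ ∃c (∀s (mem (# 0) (# 0) ⇔₂ ren2 id suc P)) ⟧′ ρ σ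
      witness ρ σ = ≤-trans (⋀-glb _ _ λ a → ≈⇒⊤≤⇔ (E-defines-P a)) (⋁-upper _ E)
        where
          J = jointDefinition σ
          open JointDefinition J
          open ClassElimination Q

          E : Class
          E = (λ a → ⟦ elimClasses P ⟧ᴹ (a ∷ (ρ ++ c)))
            , k + K , elimClasses P , ρ ++ c , λ _ → Eq.refl

          E-defines-P : ∀ a → proj₁ E a ≈ ⟦ ren2 id suc P ⟧′ (a ∷ ρ) (E ∷ σ)
          E-defines-P a = Eq.trans
            (⟦elimClasses⟧ J P P-nq (λ { zero → refl ; (suc i) → lookup-++ˡ ρ c i })
              (lookup-++ʳ ρ c))
            (Eq.sym (⟦ren2⟧ id suc P (λ _ → refl) (λ _ → refl)))

  Zclass-axiom-valid : ∀ {φ} → AxZclass φ → ∀ ρ σ → ⊤ ≤ ⟦ φ ⟧′ ρ σ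
  Zclass-axiom-valid eqRefl                 = emb-valid eqRefl
  Zclass-axiom-valid eqTrans                = emb-valid eqTrans
  Zclass-axiom-valid eqMemL                 = emb-valid eqMemL
  Zclass-axiom-valid eqMemR                 = emb-valid eqMemR
  Zclass-axiom-valid memEq                  = memEq-valid
  Zclass-axiom-valid (strongExt k m R R-nq) = strongExt-valid k m R R-nq
  Zclass-axiom-valid (restrComp k m P P-nq) = restrComp-valid k m P P-nq
  Zclass-axiom-valid pairing                = emb-valid pairing
  Zclass-axiom-valid union                  = emb-valid union
  Zclass-axiom-valid powerset               = emb-valid powerset
  Zclass-axiom-valid infinity               = emb-valid infinity
  Zclass-axiom-valid transClosure           = emb-valid transClosure
  Zclass-axiom-valid (classComp k m P P-nq) = classComp-valid k m P P-nq

proposition2 : (B : CompleteHeytingAlgebra) (M : ZStructure B) →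
    IsZstModel M → IsZclassModel (M' M)
proposition2 B M model φ ax = antisym (maximum _) (Validity.Zclass-axiom-valid M model ax _ _)
  where open CompleteHeytingAlgebra B
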